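{- For every $m\ge 1$, every 2D word of size $(m,2)$ (over any finite alphabet) has at most $2m$ distinct non-empty HV-palindromic factors, and this maximum $2m$ is attained by some 2D word of size $(m,2)$.
   Context: A 2D word of size $(m,n)$ over a finite alphabet $\Sigma$ is an $m\times n$ array $w=[w_{i,j}]$ with entries in $\Sigma$; its rows and columns are 1D words. A factor of $w$ is a sub-array $[w_{i,j}]_{a\le i\le b,\,c\le j\le d}$ with $1\le a\le b\le m$, $1\le c\le d\le n$; factors are counted as distinct arrays, independently of their positions. A 1D word is a palindrome if it equals its reversal, and a 2D word is an HV-palindrome if each of its rows and each of its columns is a 1D palindrome. -}

module Defs where

open import Data.Nat using (ℕ; suc; _+_; _≤_)
open import Data.Fin using (Fin; toℕ)
open import Data.Maybe using (Maybe; just; nothing)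
open import Data.Product using (Σ; ∃; _×_)
open import Data.Vec using (Vec; []; _∷_; lookup; reverse; transpose)
open import Data.Vec.Relation.Unary.All using (All)
open import Relation.Binary.PropositionalEquality using (_≡_)

Word2D : Set → ℕ → ℕ → Set
Word2D A m n = Vec (Vec A n) m

IsPalindrome : {A : Set} {n : ℕ} → Vec A n → Set
IsPalindrome v = reverse v ≡ v

IsHVPalindrome : {A : Set} {m n : ℕ} → Word2D A m n → Set
IsHVPalindrome w = All IsPalindrome w × All IsPalindrome (transpose w)

-- A 2D array of arbitrary size, packaged with its size; two such arrays are
-- equal iff they have the same size and the same entries.
Array2D : Set → Set
Array2D A = Σ ℕ λ p → Σ ℕ λ q → Word2D A p q

atVec : {A : Set} {n : ℕ} → Vec A n → ℕ → Maybe A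
atVec [] _ = nothing
atVec (x ∷ xs) 0 = just x
atVec (x ∷ xs) (suc i) = atVec xs i

at : {A : Set} {m n : ℕ} → Word2D A m n → ℕ → ℕ → Maybe A
at [] _ _ = nothing
at (r ∷ rs) 0 j = atVec r j
at (r ∷ rs) (suc i) j = at rs i j

OccursAt : {A : Set} {m n p q : ℕ} → Word2D A m n → Word2D A p q → ℕ → ℕ → Set
OccursAt {m = m} {n} {p} {q} w f a c =
  (a + p ≤ m) × (c + q ≤ n) ×
  ((x : Fin p) (y : Fin q) →
     at w (a + toℕ x) (c + toℕ y) ≡ just (lookup (lookup f x) y))

IsFactor : {A : Set} {m n p q : ℕ} → Word2D A m n → Word2D A p q → Set
IsFactor w f = ∃ λ a → ∃ λ c → OccursAt w f a c

IsNEHVPalFactor : {A : Set} {m n : ℕ} → Word2D A m n → Array2D A → Set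
IsNEHVPalFactor w (p Data.Product., q Data.Product., f) =
  (1 ≤ p) × (1 ≤ q) × IsFactor w f × IsHVPalindrome f

-- A word c has at most |c| distinct nonempty palindromic factors: a palindromic factor of
-- x ∷ c that does not occur in c is a prefix of x ∷ c, and of two palindromic prefixes the
-- shorter one is also a suffix of the longer one, hence occurs in c; so at most one is new.
-- A nonempty HV-palindromic factor of a word with two columns c₀, c₁ has width 1 or 2 and is
-- determined by its first column. That column is a palindromic factor of c₀ or of c₁ when the
-- width is 1, and of both when the width is 2 (rows ab are palindromes, so both columns agree).
-- Counting thin factors in P(c₀) ∪ P(c₁) and wide ones in P(c₀) ∩ P(c₁) gives at most
-- |P(c₀)| + |P(c₁)| ≤ 2m. The word with all rows 01 attains this with its columns 0ʰ and 1ʰ.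
module Submission where

open import Defs
open import Data.Nat using (ℕ; _≤_; _*_)
open import Data.Fin using (Fin)
open import Data.List using (List; length)
open import Data.List.Relation.Unary.All using (All)
open import Data.List.Relation.Unary.Unique.Propositional using (Unique)
open import Data.Product using (Σ; ∃; _×_)
open import Relation.Binary.PropositionalEquality using (_≡_)

open import Data.Nat using (zero; suc; _+_; _<_; z≤n; s≤s)
import Data.Nat.Properties as ℕ
open import Data.Fin as Fin using (toℕ)
import Data.Fin.Properties as Fin
open import Data.Maybe using (just)
open import Data.Maybe.Properties using (just-injective)
open import Data.List as List using ([]; _∷_; _++_; filter; map; reverse; cartesianProduct)
import Data.List.Properties as List
open import Data.List.Relation.Unary.All as All using ([]; _∷_)
open import Data.List.Relation.Unary.All.Properties
  using (all-filter; ++⁺) renaming (filter⁺ to All-filter⁺; map⁺ to All-map⁺)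
open import Data.List.Relation.Unary.AllPairs using ([]; _∷_)
import Data.List.Relation.Unary.Unique.Propositional.Properties as Unique
open import Data.List.Relation.Binary.Prefix.Heterogeneous using (Prefix; []; _∷_)
open import Data.List.Relation.Binary.Suffix.Heterogeneous using (Suffix; here; there)
open import Data.List.Relation.Binary.Suffix.Heterogeneous.Properties using (fromPrefix)
open import Data.List.Relation.Binary.Infix.Heterogeneous using (Infix; here; there)
open import Data.List.Relation.Binary.Infix.Heterogeneous.Properties using (infix?; fromSuffixPrefix)
open import Data.List.Relation.Binary.Pointwise using (Pointwise-≡⇒≡)
open import Data.Vec as Vec using (Vec; []; _∷_; lookup; toList; _⊛_)
import Data.Vec.Properties as Vec
import Data.Vec.Relation.Unary.All as VAll
open import Data.Vec.Relation.Unary.All using ([]; _∷_)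
import Data.Vec.Relation.Unary.All.Properties as VAll
open import Data.Empty using (⊥-elim)
open import Data.Product using (_,_; proj₁; proj₂)
open import Data.Sum as Sum using (_⊎_; inj₁; inj₂; [_,_])
open import Function using (id; const; _∘_; _$_; _∋_)
open import Relation.Nullary using (¬_; ¬?; yes; no; _×-dec_)
open import Relation.Unary using (Decidable; ∁; _∪_; _∩_)
open import Relation.Unary.Properties using (∁?)
open import Relation.Binary.Definitions using (DecidableEquality)
open import Relation.Binary.PropositionalEquality
  using (_≢_; refl; sym; trans; cong; cong₂; subst; subst₂; module ≡-Reasoning)

module _ {B : Set} where

  length-filter+filter-∁ : ∀ {P : B → Set} (P? : Decidable P) xs →
    length xs ≡ length (filter P? xs) + length (filter (∁? P?) xs)
  length-filter+filter-∁ P? [] = refl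
  length-filter+filter-∁ P? (x ∷ xs) with P? x
  ... | yes _ = cong suc (length-filter+filter-∁ P? xs)
  ... | no _  = trans (cong suc (length-filter+filter-∁ P? xs)) (sym (ℕ.+-suc _ _))

  unique-length≤1 : ∀ {Q : B → Set} → (∀ {x y} → Q x → Q y → x ≡ y) →
    ∀ {xs} → Unique xs → All Q xs → length xs ≤ 1
  unique-length≤1 Q-prop {[]}        _                 _              = z≤n
  unique-length≤1 Q-prop {_ ∷ []}    _                 _              = s≤s z≤n
  unique-length≤1 Q-prop {_ ∷ _ ∷ _} ((x≢y ∷ _) ∷ _) (qx ∷ qy ∷ _) = ⊥-elim (x≢y (Q-prop qx qy))

  unique-map⁺ : ∀ {C : Set} {Q : B → Set} (f : B → C) →
    (∀ {x y} → Q x → Q y → f x ≡ f y → x ≡ y) →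
    ∀ {xs} → All Q xs → Unique xs → Unique (map f xs)
  unique-map⁺ f f-inj [] [] = []
  unique-map⁺ f f-inj (qx ∷ qxs) (x∉xs ∷ u) =
    All-map⁺ (All.zipWith (λ (qy , x≢y) fx≡fy → x≢y (f-inj qx qy fx≡fy)) (qxs , x∉xs))
    ∷ unique-map⁺ f f-inj qxs u

module _ {B : Set} {P Q : B → Set} (P? : Decidable P) {a b : ℕ}
  (P-bound : ∀ {xs} → Unique xs → All P xs → length xs ≤ a)
  (Q-bound : ∀ {xs} → Unique xs → All Q xs → length xs ≤ b) where

  union-intersection-length≤ : ∀ {xs ys} → Unique xs → Unique ys →
    All (P ∪ Q) xs → All (P ∩ Q) ys → length xs + length ys ≤ a + b
  union-intersection-length≤ {xs} {ys} uxs uys pq-xs pq-ys = begin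
    length xs + length ys                   ≡⟨ cong (_+ length ys) (length-filter+filter-∁ P? xs) ⟩
    length inP + length outP + length ys    ≡⟨ ℕ.+-assoc (length inP) _ _ ⟩
    length inP + (length outP + length ys)  ≡⟨ cong (length inP +_) (List.length-++ outP) ⟨
    length inP + length (outP ++ ys)        ≤⟨ ℕ.+-mono-≤ (P-bound u-inP (all-filter P? xs))
                                                          (Q-bound u-rest q-rest) ⟩
    a + b                                   ∎
    where
      open ℕ.≤-Reasoning
      inP outP : List B
      inP  = filter P? xs
      outP = filter (∁? P?) xs
      ¬P-outP : All (∁ P) outP
      ¬P-outP = all-filter (∁? P?) xs
      u-inP : Unique inP
      u-inP = Unique.filter⁺ P? uxs
      u-rest : Unique (outP ++ ys)
      u-rest = Unique.++⁺ (Unique.filter⁺ (∁? P?) uxs) uys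
        λ (v∈outP , v∈ys) → All.lookup ¬P-outP v∈outP (proj₁ (All.lookup pq-ys v∈ys))
      q-rest : All Q (outP ++ ys)
      q-rest = ++⁺ (All.zipWith (λ (p⊎q , ¬p) → [ ⊥-elim ∘ ¬p , id ] p⊎q)
                                (All-filter⁺ (∁? P?) pq-xs , ¬P-outP))
                   (All.map proj₂ pq-ys)

module _ {A : Set} where

  Palindrome : List A → Set
  Palindrome u = reverse u ≡ u

  IsNEPalFactor : List A → List A → Set
  IsNEPalFactor c u = u ≢ [] × Palindrome u × Infix _≡_ u c

  prefix-total : ∀ {u v w : List A} → Prefix _≡_ u w → Prefix _≡_ v w →
    Prefix _≡_ u v ⊎ Prefix _≡_ v u
  prefix-total []         _          = inj₁ []
  prefix-total (_ ∷ _)    []         = inj₂ []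
  prefix-total (refl ∷ p) (refl ∷ q) = Sum.map (refl ∷_) (refl ∷_) (prefix-total p q)

  palindrome-prefix⇒suffix : ∀ {u v : List A} → Palindrome u → Palindrome v →
    Prefix _≡_ u v → Suffix _≡_ u v
  palindrome-prefix⇒suffix pal-u pal-v u⊑v = subst₂ (Suffix _≡_) pal-u pal-v (fromPrefix u⊑v)

  palindrome-prefix-occurs : ∀ {x c} {u v : List A} → Palindrome u → Palindrome v →
    Prefix _≡_ u v → Prefix _≡_ v (x ∷ c) → u ≡ v ⊎ Infix _≡_ u c
  palindrome-prefix-occurs pal-u pal-v u⊑v v⊑xc
    with palindrome-prefix⇒suffix pal-u pal-v u⊑v | v⊑xc
  ... | here u≋v   | _           = inj₁ (Pointwise-≡⇒≡ u≋v)
  ... | there u⊒v′ | refl ∷ v′⊑c = inj₂ (fromSuffixPrefix trans u⊒v′ v′⊑c)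

  NewPalFactor : A → List A → List A → Set
  NewPalFactor x c u = IsNEPalFactor (x ∷ c) u × ¬ Infix _≡_ u c

  new-palFactor-prefix : ∀ {x c u} → NewPalFactor x c u → Prefix _≡_ u (x ∷ c)
  new-palFactor-prefix ((_ , _ , here u⊑xc) , _)     = u⊑xc
  new-palFactor-prefix ((_ , _ , there u⊑c) , u⋢c) = ⊥-elim (u⋢c u⊑c)

  new-palFactor-unique : ∀ {x c u v} → NewPalFactor x c u → NewPalFactor x c v → u ≡ v
  new-palFactor-unique new-u@((_ , pal-u , _) , u⋢c) new-v@((_ , pal-v , _) , v⋢c)
    with prefix-total (new-palFactor-prefix new-u) (new-palFactor-prefix new-v)
  ... | inj₁ u⊑v = [ id , ⊥-elim ∘ u⋢c ]
                     (palindrome-prefix-occurs pal-u pal-v u⊑v (new-palFactor-prefix new-v))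
  ... | inj₂ v⊑u = [ sym , ⊥-elim ∘ v⋢c ]
                     (palindrome-prefix-occurs pal-v pal-u v⊑u (new-palFactor-prefix new-u))

module _ {A : Set} (_≟_ : DecidableEquality A) where

  palFactors-length≤ : ∀ (c : List A) {us} → Unique us → All (IsNEPalFactor c) us →
    length us ≤ length c
  palFactors-length≤ []      {[]}    _ _ = z≤n
  palFactors-length≤ []      {_ ∷ _} _ ((u≢[] , _ , here []) ∷ _) = ⊥-elim (u≢[] refl)
  palFactors-length≤ (x ∷ c) {us} u-us pf-us = begin
    length us                  ≡⟨ length-filter+filter-∁ old? us ⟩
    length old + length new    ≤⟨ ℕ.+-mono-≤ old-bound new-bound ⟩
    length c + 1               ≡⟨ ℕ.+-comm (length c) 1 ⟩
    length (x ∷ c)             ∎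
    where
      open ℕ.≤-Reasoning
      old? : Decidable (λ u → Infix _≡_ u c)
      old? u = infix? _≟_ u c
      old new : List (List A)
      old = filter old? us
      new = filter (∁? old?) us
      old-bound : length old ≤ length c
      old-bound = palFactors-length≤ c (Unique.filter⁺ old? u-us)
        (All.zipWith (λ ((u≢[] , pal , _) , u⊑c) → u≢[] , pal , u⊑c)
                     (All-filter⁺ old? pf-us , all-filter old? us))
      new-bound : length new ≤ 1
      new-bound = unique-length≤1 new-palFactor-unique (Unique.filter⁺ (∁? old?) u-us)
        (All.zip (All-filter⁺ (∁? old?) pf-us , all-filter (∁? old?) us))

module _ {A : Set} where

  column : ∀ {m n} → Fin n → Word2D A m n → Vec A m
  column j = Vec.map (λ row → lookup row j)

  width : Array2D A → ℕ
  width (_ , q , _) = q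

  firstColumn : Array2D A → List A
  firstColumn (_ , zero  , f) = []
  firstColumn (_ , suc _ , f) = toList (column Fin.zero f)

  lookup-transpose : ∀ {m n} (w : Word2D A m n) j → lookup (Vec.transpose w) j ≡ column j w
  lookup-transpose []      j = Vec.lookup-replicate j []
  lookup-transpose {n = n} (r ∷ w) j = begin
    lookup (conses ⊛ r ⊛ Vec.transpose w) j  ≡⟨ Vec.lookup-⊛ j (conses ⊛ r) _ ⟩
    lookup (conses ⊛ r) j rest               ≡⟨ cong (_$ rest) (Vec.lookup-⊛ j conses r) ⟩
    lookup conses j (lookup r j) rest        ≡⟨ cong (λ g → g (lookup r j) rest) (Vec.lookup-replicate j Vec._∷_) ⟩
    lookup r j ∷ rest                        ≡⟨ cong (lookup r j ∷_) (lookup-transpose w j) ⟩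
    lookup r j ∷ column j w                  ∎
    where
      open ≡-Reasoning
      conses : Vec (A → Vec A _ → Vec A _) n
      conses = Vec.replicate n Vec._∷_
      rest : Vec A _
      rest = lookup (Vec.transpose w) j

  atVec-toℕ : ∀ {n} (v : Vec A n) j → atVec v (toℕ j) ≡ just (lookup v j)
  atVec-toℕ (x ∷ v) Fin.zero    = refl
  atVec-toℕ (x ∷ v) (Fin.suc j) = atVec-toℕ v j

  at-column : ∀ {m n} (w : Word2D A m n) i j → at w i (toℕ j) ≡ atVec (column j w) i
  at-column []      i       j = refl
  at-column (r ∷ w) zero    j = atVec-toℕ r j
  at-column (r ∷ w) (suc i) j = at-column w i j

  atVec-prefix : ∀ {n p} (v : Vec A n) (g : Vec A p) →
    (∀ x → atVec v (toℕ x) ≡ just (lookup g x)) → Prefix _≡_ (toList g) (toList v)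
  atVec-prefix v       []      _ = []
  atVec-prefix []      (z ∷ g) h with () ← h Fin.zero
  atVec-prefix (y ∷ v) (z ∷ g) h = sym (just-injective (h Fin.zero)) ∷ atVec-prefix v g (h ∘ Fin.suc)

  atVec-infix : ∀ {n p} (v : Vec A n) a (g : Vec A p) →
    (∀ x → atVec v (a + toℕ x) ≡ just (lookup g x)) → Infix _≡_ (toList g) (toList v)
  atVec-infix v       zero    g       h = here (atVec-prefix v g h)
  atVec-infix (y ∷ v) (suc a) g       h = there (atVec-infix v a g h)
  atVec-infix []      (suc a) []      h = here []
  atVec-infix []      (suc a) (z ∷ g) h with () ← h Fin.zero

  column-occurs : ∀ {m n p q} {w : Word2D A m n} {f : Word2D A p q} {a c} →
    OccursAt w f a c → ∀ y j → toℕ j ≡ c + toℕ y →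
    Infix _≡_ (toList (column y f)) (toList (column j w))
  column-occurs {w = w} {f} {a} {c} (_ , _ , occ) y j j≡c+y =
    atVec-infix (column j w) a (column y f) λ x → begin
      atVec (column j w) (a + toℕ x)  ≡⟨ at-column w (a + toℕ x) j ⟨
      at w (a + toℕ x) (toℕ j)         ≡⟨ cong (at w (a + toℕ x)) j≡c+y ⟩
      at w (a + toℕ x) (c + toℕ y)     ≡⟨ occ x y ⟩
      just (lookup (lookup f x) y)     ≡⟨ cong just (Vec.lookup-map x _ f) ⟨
      just (lookup (column y f) x)     ∎
    where open ≡-Reasoning

  toList-palindrome : ∀ {n} {v : Vec A n} → IsPalindrome v → Palindrome (toList v)
  toList-palindrome {v = v} pal = trans (sym (Vec.toList-reverse v)) (cong toList pal)

  column-palFactor : ∀ {m n p q} {w : Word2D A m n} {f : Word2D A p q} {a c} →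
    1 ≤ p → OccursAt w f a c → IsHVPalindrome f → ∀ y j → toℕ j ≡ c + toℕ y →
    IsNEPalFactor (toList (column j w)) (toList (column y f))
  column-palFactor {f = _ ∷ _} _ occ (_ , pal-cols) y j j≡c+y =
    (λ ()) ,
    toList-palindrome (subst IsPalindrome (lookup-transpose _ y) (VAll.lookup⁺ pal-cols y)) ,
    column-occurs occ y j j≡c+y

  same-firstColumn : ∀ {p p′ q} (rebuild : A → Vec A (suc q))
    {f : Word2D A p (suc q)} {f′ : Word2D A p′ (suc q)} →
    Vec.map rebuild (column Fin.zero f) ≡ f → Vec.map rebuild (column Fin.zero f′) ≡ f′ →
    firstColumn (p , suc q , f) ≡ firstColumn (p′ , suc q , f′) →
    (p , suc q , f) ≡ (p′ , suc q , f′)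
  same-firstColumn {p} {p′} {q} rebuild {f} {f′} f-rebuilt f′-rebuilt same
    with refl ← trans (sym (Vec.length-toList (column Fin.zero f)))
                      (trans (cong length same) (Vec.length-toList (column Fin.zero f′)))
    = cong (λ (g : Word2D A p (suc q)) → (Array2D A ∋ (p , suc q , g))) (begin
      f                                       ≡⟨ f-rebuilt ⟨
      Vec.map rebuild (column Fin.zero f)     ≡⟨ cong (Vec.map rebuild) same-column ⟩
      Vec.map rebuild (column Fin.zero f′)    ≡⟨ f′-rebuilt ⟩
      f′                                      ∎)
    where
      open ≡-Reasoning
      same-column : column Fin.zero f ≡ column Fin.zero f′
      same-column = trans (sym (Vec.cast-is-id refl _)) (Vec.toList-injective refl _ _ same)

  singleton-columns : ∀ {p} (f : Word2D A p 1) → Vec.map Vec.[_] (column Fin.zero f) ≡ f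
  singleton-columns []             = refl
  singleton-columns ((a ∷ []) ∷ f) = cong (_ ∷_) (singleton-columns f)

  palindromic-rows⇒doubled-column : ∀ {p} (f : Word2D A p 2) → VAll.All IsPalindrome f →
    Vec.map (λ a → a ∷ a ∷ []) (column Fin.zero f) ≡ f
  palindromic-rows⇒doubled-column []                 []           = refl
  palindromic-rows⇒doubled-column ((a ∷ _ ∷ []) ∷ f) (refl ∷ pals) =
    cong (_ ∷_) (palindromic-rows⇒doubled-column f pals)

  palindromic-rows⇒equal-columns : ∀ {p} (f : Word2D A p 2) → VAll.All IsPalindrome f →
    column (Fin.suc Fin.zero) f ≡ column Fin.zero f
  palindromic-rows⇒equal-columns []                 []           = refl
  palindromic-rows⇒equal-columns ((a ∷ _ ∷ []) ∷ f) (refl ∷ pals) =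
    cong (a ∷_) (palindromic-rows⇒equal-columns f pals)

  hvPalFactor-width≤ : ∀ {m n p q} {w : Word2D A m n} {f : Word2D A p q} →
    IsNEHVPalFactor w (p , q , f) → q ≤ n
  hvPalFactor-width≤ (_ , _ , (_ , c , _ , c+q≤n , _) , _) = ℕ.m+n≤o⇒n≤o c c+q≤n

  thin-hvPalFactor : ∀ {m n p} {w : Word2D A m n} {f : Word2D A p 1} →
    IsNEHVPalFactor w (p , 1 , f) →
    Σ (Fin n) λ j → IsNEPalFactor (toList (column j w)) (firstColumn (p , 1 , f))
  thin-hvPalFactor {n = n} (1≤p , _ , (_ , c , occ@(_ , c+1≤n , _)) , hv) =
    Fin.fromℕ< c<n ,
    column-palFactor 1≤p occ hv Fin.zero (Fin.fromℕ< c<n)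
      (trans (Fin.toℕ-fromℕ< c<n) (sym (ℕ.+-identityʳ c)))
    where
      c<n : c < n
      c<n = subst (_≤ n) (ℕ.+-comm c 1) c+1≤n

module TwoColumns {A : Set} (_≟_ : DecidableEquality A) {m : ℕ} (w : Word2D A m 2) where

  left right : List A
  left  = toList (column Fin.zero w)
  right = toList (column (Fin.suc Fin.zero) w)

  Thin Wide : Array2D A → Set
  Thin e = IsNEHVPalFactor w e × width e ≡ 1
  Wide e = IsNEHVPalFactor w e × width e ≢ 1

  wide-width : ∀ {e} → Wide e → width e ≡ 2
  wide-width {_ , zero          , _} ((_ , () , _) , _)
  wide-width {_ , 1             , _} (_ , q≢1) = ⊥-elim (q≢1 refl)
  wide-width {_ , 2             , _} _ = refl
  wide-width {_ , suc (suc (suc q)) , _} (hv , _) with s≤s (s≤s ()) ← hvPalFactor-width≤ {w = w} hv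

  wide-hvPalFactor : ∀ {p} {f : Word2D A p 2} → IsNEHVPalFactor w (p , 2 , f) →
    (IsNEPalFactor left ∩ IsNEPalFactor right) (firstColumn (p , 2 , f))
  wide-hvPalFactor {f = f} (1≤p , _ , (_ , zero , occ) , hv@(pal-rows , _)) =
    column-palFactor 1≤p occ hv Fin.zero Fin.zero refl ,
    subst (IsNEPalFactor _ ∘ toList) (palindromic-rows⇒equal-columns f pal-rows)
      (column-palFactor 1≤p occ hv (Fin.suc Fin.zero) (Fin.suc Fin.zero) refl)
  wide-hvPalFactor (_ , _ , (_ , suc c , _ , s≤s c+2≤1 , _) , _)
    with s≤s () ← ℕ.m+n≤o⇒n≤o c c+2≤1

  thin-firstColumn : ∀ {e} → Thin e → (IsNEPalFactor left ∪ IsNEPalFactor right) (firstColumn e)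
  thin-firstColumn {_ , _ , _} (hv , refl) with thin-hvPalFactor {w = w} hv
  ... | Fin.zero          , pf = inj₁ pf
  ... | Fin.suc Fin.zero , pf = inj₂ pf

  wide-firstColumn : ∀ {e} → Wide e → (IsNEPalFactor left ∩ IsNEPalFactor right) (firstColumn e)
  wide-firstColumn {_ , _ , _} wide@(hv , _) with refl ← wide-width wide = wide-hvPalFactor hv

  thin-injective : ∀ {e e′} → Thin e → Thin e′ → firstColumn e ≡ firstColumn e′ → e ≡ e′
  thin-injective {_ , _ , f} {_ , _ , f′} (_ , refl) (_ , refl) =
    same-firstColumn Vec.[_] (singleton-columns f) (singleton-columns f′)

  wide-injective : ∀ {e e′} → Wide e → Wide e′ → firstColumn e ≡ firstColumn e′ → e ≡ e′
  wide-injective {_ , _ , f} {_ , _ , f′} wide@((_ , _ , _ , pal-rows , _) , _)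
                                            wide′@((_ , _ , _ , pal-rows′ , _) , _)
    with refl ← wide-width wide | refl ← wide-width wide′ =
    same-firstColumn (λ a → a ∷ a ∷ [])
      (palindromic-rows⇒doubled-column f pal-rows) (palindromic-rows⇒doubled-column f′ pal-rows′)

  thin? : Decidable {A = Array2D A} (λ e → width e ≡ 1)
  thin? e = width e ℕ.≟ 1

  nePalFactor? : ∀ c → Decidable (IsNEPalFactor c)
  nePalFactor? c u =
    ¬? (List.≡-dec _≟_ u []) ×-dec List.≡-dec _≟_ (reverse u) u ×-dec infix? _≟_ u c

  hvPalFactors-length≤ : ∀ {es} → Unique es → All (IsNEHVPalFactor w) es → length es ≤ 2 * m
  hvPalFactors-length≤ {es} u-es hv-es = begin
    length es                                   ≡⟨ length-filter+filter-∁ thin? es ⟩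
    length thins + length wides                 ≡⟨ cong₂ _+_ (List.length-map firstColumn thins)
                                                              (List.length-map firstColumn wides) ⟨
    length (map firstColumn thins) + length (map firstColumn wides)
      ≤⟨ union-intersection-length≤ (nePalFactor? left)
           (palFactors-length≤ _≟_ left) (palFactors-length≤ _≟_ right)
           (unique-map⁺ firstColumn thin-injective thin-es (Unique.filter⁺ thin? u-es))
           (unique-map⁺ firstColumn wide-injective wide-es (Unique.filter⁺ (∁? thin?) u-es))
           (All-map⁺ (All.map thin-firstColumn thin-es))
           (All-map⁺ (All.map wide-firstColumn wide-es)) ⟩
    length left + length right                  ≡⟨ cong₂ _+_ (Vec.length-toList (column Fin.zero w))
                                                              (Vec.length-toList (column (Fin.suc Fin.zero) w)) ⟩
    m + m                                       ≡⟨ cong (m +_) (ℕ.+-identityʳ m) ⟨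
    2 * m                                       ∎
    where
      open ℕ.≤-Reasoning
      thins wides : List (Array2D A)
      thins = filter thin? es
      wides = filter (∁? thin?) es
      thin-es : All Thin thins
      thin-es = All.zip (All-filter⁺ thin? hv-es , all-filter thin? es)
      wide-es : All Wide wides
      wide-es = All.zip (All-filter⁺ (∁? thin?) hv-es , all-filter (∁? thin?) es)

module _ {A : Set} where

  replicate-palindrome : ∀ h (a : A) → IsPalindrome (Vec.replicate h a)
  replicate-palindrome h a = begin
    Vec.reverse aʰ                     ≡⟨ cong Vec.reverse (Vec.map-const aʰ a) ⟨
    Vec.reverse (Vec.map (const a) aʰ) ≡⟨ Vec.map-reverse (const a) aʰ ⟨
    Vec.map (const a) (Vec.reverse aʰ) ≡⟨ Vec.map-const (Vec.reverse aʰ) a ⟩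
    aʰ                                 ∎
    where
      open ≡-Reasoning
      aʰ : Vec A h
      aʰ = Vec.replicate h a

  all-replicate : ∀ {B : Set} {P : B → Set} h {b} → P b → VAll.All P (Vec.replicate h b)
  all-replicate zero    pb = []
  all-replicate (suc h) pb = pb ∷ all-replicate h pb

  constantColumn : ℕ → A → Array2D A
  constantColumn h a = h , 1 , Vec.replicate h Vec.[ a ]

  constantColumn-hvPalindrome : ∀ h (a : A) → IsHVPalindrome (Vec.replicate h Vec.[ a ])
  constantColumn-hvPalindrome h a =
    all-replicate h refl ,
    subst (VAll.All IsPalindrome) (sym (Vec.transpose-replicate Vec.[ a ]))
      (replicate-palindrome h a ∷ [])

  at-replicate : ∀ {n} m (r : Vec A n) i j → i < m → at (Vec.replicate m r) i j ≡ atVec r j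
  at-replicate (suc m) r zero    j _         = refl
  at-replicate (suc m) r (suc i) j (s≤s i<m) = at-replicate m r i j i<m

length-cartesianProduct : ∀ {B C : Set} (xs : List B) (ys : List C) →
  length (cartesianProduct xs ys) ≡ length xs * length ys
length-cartesianProduct []       ys = refl
length-cartesianProduct (x ∷ xs) ys = begin
  length (map (x ,_) ys ++ cartesianProduct xs ys)          ≡⟨ List.length-++ (map (x ,_) ys) ⟩
  length (map (x ,_) ys) + length (cartesianProduct xs ys)  ≡⟨ cong₂ _+_ (List.length-map (x ,_) ys)
                                                                          (length-cartesianProduct xs ys) ⟩
  length ys + length xs * length ys                         ∎
  where open ≡-Reasoning

columnsWord : ∀ m n → Word2D (Fin n) m n
columnsWord m n = Vec.replicate m (Vec.allFin n)

constantColumnOfHeight : ∀ {m n} → Fin n × Fin m → Array2D (Fin n)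
constantColumnOfHeight (a , j) = constantColumn (suc (toℕ j)) a

constantColumns : ∀ m n → List (Array2D (Fin n))
constantColumns m n = map constantColumnOfHeight (cartesianProduct (List.allFin n) (List.allFin m))

constantColumns-length : ∀ m n → length (constantColumns m n) ≡ n * m
constantColumns-length m n = begin
  length (constantColumns m n)           ≡⟨ List.length-map constantColumnOfHeight (cartesianProduct as js) ⟩
  length (cartesianProduct as js)        ≡⟨ length-cartesianProduct as js ⟩
  length as * length js                  ≡⟨ cong₂ _*_ (List.length-tabulate {n = n} id)
                                                      (List.length-tabulate {n = m} id) ⟩
  n * m                                  ∎
  where
    open ≡-Reasoning
    as : List (Fin n)
    as = List.allFin n
    js : List (Fin m)
    js = List.allFin m

constantColumns-unique : ∀ m n → Unique (constantColumns m n)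
constantColumns-unique m n =
  Unique.map⁺ injective (Unique.cartesianProduct⁺ (Unique.allFin⁺ n) (Unique.allFin⁺ m))
  where
    injective : ∀ {x y} → constantColumnOfHeight {m} {n} x ≡ constantColumnOfHeight y → x ≡ y
    injective same = cong₂ _,_ (List.∷-injectiveˡ (cong firstColumn same))
                               (Fin.toℕ-injective (ℕ.suc-injective (cong proj₁ same)))

constantColumns-hvPalFactors : ∀ m n → All (IsNEHVPalFactor (columnsWord m n)) (constantColumns m n)
constantColumns-hvPalFactors m n = All-map⁺ (All.universal occurs _)
  where
    w : Word2D (Fin n) m n
    w = columnsWord m n

    occurs : ∀ aj → IsNEHVPalFactor w (constantColumnOfHeight aj)
    occurs (a , j) =
      s≤s z≤n , s≤s z≤n ,
      (0 , toℕ a , Fin.toℕ<n j , subst (_≤ n) (ℕ.+-comm 1 (toℕ a)) (Fin.toℕ<n a) , entry) ,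
      constantColumn-hvPalindrome (suc (toℕ j)) a
      where
        open ≡-Reasoning
        f : Word2D (Fin n) (suc (toℕ j)) 1
        f = Vec.replicate (suc (toℕ j)) Vec.[ a ]
        entry : ∀ x y → at w (toℕ x) (toℕ a + toℕ y) ≡ just (lookup (lookup f x) y)
        entry x Fin.zero = begin
          at w (toℕ x) (toℕ a + 0)             ≡⟨ cong (at w (toℕ x)) (ℕ.+-identityʳ (toℕ a)) ⟩
          at w (toℕ x) (toℕ a)                 ≡⟨ at-replicate m (Vec.allFin n) (toℕ x) (toℕ a)
                                                    (ℕ.<-≤-trans (Fin.toℕ<n x) (Fin.toℕ<n j)) ⟩
          atVec (Vec.allFin n) (toℕ a)         ≡⟨ atVec-toℕ (Vec.allFin n) a ⟩
          just (lookup (Vec.allFin n) a)       ≡⟨ cong just (Vec.lookup-allFin a) ⟩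
          just a                               ≡⟨ cong (λ r → just (lookup r Fin.zero)) (Vec.lookup-replicate x Vec.[ a ]) ⟨
          just (lookup (lookup f x) Fin.zero)  ∎

corollary5p2 : (m : ℕ) → 1 ≤ m →
    ((k : ℕ) (w : Word2D (Fin k) m 2) (L : List (Array2D (Fin k))) →
       Unique L → All (IsNEHVPalFactor w) L → length L ≤ 2 * m)
    × (∃ λ k → Σ (Word2D (Fin k) m 2) λ w → Σ (List (Array2D (Fin k))) λ L →
         Unique L × All (IsNEHVPalFactor w) L × length L ≡ 2 * m)
corollary5p2 m _ =
  (λ k w L → TwoColumns.hvPalFactors-length≤ Fin._≟_ w) ,
  (2 , columnsWord m 2 , constantColumns m 2 ,
   constantColumns-unique m 2 , constantColumns-hvPalFactors m 2 , constantColumns-length m 2)
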